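{- Let $K$ be a commutative semiring, $A$ a finite alphabet, $X$ a finite set of variables, $Z\subseteq X$, and $\phi:X\to\mathcal{T}^-_\gamma$ an assignment of guarded $\mu$-expressions (whose variables all lie in $X$) to variables. Then every $\mu$-free term $t\in\mathcal{T}_K(X)$ has a $Z$-pseudoclosure with respect to $\phi$.
   Context: $\mu$-expressions over $X$: $t::=\bar k\ (k\in K)\mid x\ (x\in X)\mid\bar a\ (a\in A)\mid t+t\mid t\times t\mid\mu x.g$ with guarded ones $g::=\bar a\times t\mid\bar k\mid g+g$; $\mathcal{T}^-_\gamma$ is the set of guarded $\mu$-expressions, and $\mathcal{T}_K(X)$ the set of $\mu$-free $\mu$-expressions (built from $\bar k$, $x\in X$, $\bar a$, $+$, $\times$). For $x\in X$, $t'$ is a single syntactic substitution of $t$ from $x$ (w.r.t. $\phi$) if: (1) $t=x$ and $t'=\mu x.\phi(x)$; or (2)/(3) $t=s+u$ and $t'=s'+u$, or $t=u+s$ and $t'=u+s'$, with $s'$ a single syntactic substitution of $s$ from $x$; or (4)/(5) the same with $\times$ in place of $+$; or (6) $t=\mu y.u$, $t'=\mu y.u'$ with $u'$ a single syntactic substitution of $u$ from $x$. (The replaced occurrence need not be free.) A chain of syntactic substitutions is a list $t_0,\dots,t_{n-1}$ ($n\ge1$) where each $t_{i+1}$ is a single syntactic substitution of $t_i$ from some variable; $t'$ is obtainable from $t$ if such a chain exists with $t_0=t$, $t_{n-1}=t'$. $t'$ is a $Z$-pseudoclosure of $t$ if $t'$ is obtainable from $t$ and all free variables of $t'$ lie in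 $Z$; a closure is an $\emptyset$-pseudoclosure. -}

module Defs where

open import Level using (Level)
open import Data.Nat using (ℕ)
open import Data.Fin using (Fin)
open import Data.Fin.Subset using (Subset; _∈_)
open import Data.Product using (Σ; ∃; _×_; _,_)
open import Relation.Nullary using (¬_)
open import Relation.Binary.PropositionalEquality using (_≡_)
open import Relation.Binary.Construct.Closure.ReflexiveTransitive using (Star)

-- μ-expressions over the variable set X = Fin n, with constants from the
-- (carrier of the) semiring K and letters from the alphabet A.
data Term {k a : Level} (K : Set k) (A : Set a) (n : ℕ) : Set (Level._⊔_ k a) where
  const : K → Term K A n
  var   : Fin n → Term K A n
  letter : A → Term K A n
  _⊕_   : Term K A n → Term K A n → Term K A n
  _⊗_   : Term K A n → Term K A n → Term K A n
  μ     : Fin n → Term K A n → Term K A n     -- μx.t (body required guarded, see WellFormed)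

module _ {k a : Level} {K : Set k} {A : Set a} {n : ℕ} where

  data Guarded : Term K A n → Set (Level._⊔_ k a) where
    g-letter : ∀ (x : A) t → Guarded (letter x ⊗ t)
    g-const  : ∀ (c : K) → Guarded (const c)
    g-plus   : ∀ {g h} → Guarded g → Guarded h → Guarded (g ⊕ h)

  data WellFormed : Term K A n → Set (Level._⊔_ k a) where
    wf-const  : ∀ c → WellFormed (const c)
    wf-var    : ∀ x → WellFormed (var x)
    wf-letter : ∀ b → WellFormed (letter b)
    wf-plus   : ∀ {s t} → WellFormed s → WellFormed t → WellFormed (s ⊕ t)
    wf-times  : ∀ {s t} → WellFormed s → WellFormed t → WellFormed (s ⊗ t)
    wf-mu     : ∀ {x g} → Guarded g → WellFormed g → WellFormed (μ x g)

  GuardedExpr : Term K A n → Set (Level._⊔_ k a)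
  GuardedExpr t = WellFormed t × Guarded t

  data MuFree : Term K A n → Set (Level._⊔_ k a) where
    mf-const  : ∀ c → MuFree (const c)
    mf-var    : ∀ x → MuFree (var x)
    mf-letter : ∀ b → MuFree (letter b)
    mf-plus   : ∀ {s t} → MuFree s → MuFree t → MuFree (s ⊕ t)
    mf-times  : ∀ {s t} → MuFree s → MuFree t → MuFree (s ⊗ t)

  data FreeIn (x : Fin n) : Term K A n → Set (Level._⊔_ k a) where
    fr-var   : FreeIn x (var x)
    fr-plusˡ : ∀ {s t} → FreeIn x s → FreeIn x (s ⊕ t)
    fr-plusʳ : ∀ {s t} → FreeIn x t → FreeIn x (s ⊕ t)
    fr-timesˡ : ∀ {s t} → FreeIn x s → FreeIn x (s ⊗ t)
    fr-timesʳ : ∀ {s t} → FreeIn x t → FreeIn x (s ⊗ t)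
    fr-mu    : ∀ {y t} → ¬ (x ≡ y) → FreeIn x t → FreeIn x (μ y t)

  -- t' is a single syntactic substitution of t from x (w.r.t. φ);
  -- the replaced occurrence need not be free.
  data SingleSubst (φ : Fin n → Term K A n) (x : Fin n)
       : Term K A n → Term K A n → Set (Level._⊔_ k a) where
    ss-var    : SingleSubst φ x (var x) (μ x (φ x))
    ss-plusˡ  : ∀ {s s' u} → SingleSubst φ x s s' → SingleSubst φ x (s ⊕ u) (s' ⊕ u)
    ss-plusʳ  : ∀ {s s' u} → SingleSubst φ x s s' → SingleSubst φ x (u ⊕ s) (u ⊕ s')
    ss-timesˡ : ∀ {s s' u} → SingleSubst φ x s s' → SingleSubst φ x (s ⊗ u) (s' ⊗ u)
    ss-timesʳ : ∀ {s s' u} → SingleSubst φ x s s' → SingleSubst φ x (u ⊗ s) (u ⊗ s')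
    ss-mu     : ∀ {y u u'} → SingleSubst φ x u u' → SingleSubst φ x (μ y u) (μ y u')

  SubstStep : (Fin n → Term K A n) → Term K A n → Term K A n → Set (Level._⊔_ k a)
  SubstStep φ t t' = ∃ λ x → SingleSubst φ x t t'

  -- t' obtainable from t: a chain t₀ = t, …, t_{m-1} = t' (m ≥ 1, i.e. ≥ 0 steps)
  Obtainable : (Fin n → Term K A n) → Term K A n → Term K A n → Set (Level._⊔_ k a)
  Obtainable φ = Star (SubstStep φ)

  IsPseudoclosure : (Fin n → Term K A n) → Subset n → Term K A n → Term K A n → Set (Level._⊔_ k a)
  IsPseudoclosure φ Z t t' = Obtainable φ t t' × (∀ x → FreeIn x t' → x ∈ Z)

-- Unfold each occurrence of a variable x into μx.φ(x) and continue inside φ(x)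
-- with x no longer pending: the occurrences of x there are bound by the new μx.
-- Each unfolding removes a variable from the finite set of pending ones, so the
-- process terminates, and its result is even closed.
module Submission where

open import Defs
open import Level using (Level; _⊔_)
open import Data.Nat using (ℕ; zero; suc; _≤_; _<_; s≤s⁻¹)
open import Data.Nat.Properties using (≤-refl; ≤-trans)
open import Data.Fin using (Fin; _≟_)
open import Data.Fin.Subset using (Subset)
open import Data.Product using (Σ; _×_; _,_)
open import Data.List using (List; _∷_; length; filter; allFin)
open import Data.List.Properties using (filter-notAll)
open import Data.List.Membership.Propositional using (_∈_; _∉_)
open import Data.List.Membership.Propositional.Properties using (∈-filter⁺; ∈-allFin)
import Data.List.Relation.Unary.Any as Any
open import Data.Empty using (⊥-elim)
open import Function using (_∘_)
open import Relation.Nullary using (¬_; ¬?; yes; no)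
open import Relation.Binary.PropositionalEquality using (_≡_; sym)
open import Relation.Binary.Definitions using (DecidableEquality)
open import Relation.Binary.Construct.Closure.ReflexiveTransitive using (ε; _◅_; _◅◅_; gmap)
open import Algebra.Bundles using (CommutativeSemiring)

module Deletion {v : Level} {V : Set v} (_≟_ : DecidableEquality V) where

  delete : V → List V → List V
  delete x = filter (¬? ∘ (_≟ x))

  length-delete≤ : ∀ {x R m} → x ∈ R → length R ≤ suc m → length (delete x R) ≤ m
  length-delete≤ {x} {R} x∈R R≤1+m = s≤s⁻¹ (≤-trans delete<R R≤1+m)
    where
    delete<R : length (delete x R) < length R
    delete<R = filter-notAll (¬? ∘ (_≟ x)) R (Any.map (λ x≡y y≢x → y≢x (sym x≡y)) x∈R)

  ∈-delete⁺ : ∀ {x y R} → ¬ y ≡ x → y ∈ R → y ∈ delete x R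
  ∈-delete⁺ {x} y≢x y∈R = ∈-filter⁺ (¬? ∘ (_≟ x)) y∈R y≢x

module _ {k a : Level} {K : Set k} {A : Set a} {n : ℕ} (φ : Fin n → Term K A n) where

  private
    T : Set (k ⊔ a)
    T = Term K A n

  open Deletion (_≟_ {n})

  obtainable-cong : (f : T → T) →
    (∀ {x s s'} → SingleSubst φ x s s' → SingleSubst φ x (f s) (f s')) →
    ∀ {s s'} → Obtainable φ s s' → Obtainable φ (f s) (f s')
  obtainable-cong f f-cong = gmap f (λ { (x , step) → x , f-cong step })

  ⊕-obtainable : ∀ {s s' t t'} → Obtainable φ s s' → Obtainable φ t t' →
                 Obtainable φ (s ⊕ t) (s' ⊕ t')
  ⊕-obtainable {s' = s'} {t = t} s↝s' t↝t' =
    obtainable-cong (_⊕ t) ss-plusˡ s↝s' ◅◅ obtainable-cong (s' ⊕_) ss-plusʳ t↝t'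

  ⊗-obtainable : ∀ {s s' t t'} → Obtainable φ s s' → Obtainable φ t t' →
                 Obtainable φ (s ⊗ t) (s' ⊗ t')
  ⊗-obtainable {s' = s'} {t = t} s↝s' t↝t' =
    obtainable-cong (_⊗ t) ss-timesˡ s↝s' ◅◅ obtainable-cong (s' ⊗_) ss-timesʳ t↝t'

  μ-obtainable : ∀ {y u u'} → Obtainable φ u u' → Obtainable φ (μ y u) (μ y u')
  μ-obtainable {y} = obtainable-cong (μ y) ss-mu

  unfold-obtainable : ∀ {x u} → Obtainable φ (φ x) u → Obtainable φ (var x) (μ x u)
  unfold-obtainable φx↝u = (_ , ss-var) ◅ μ-obtainable φx↝u

  Avoids : List (Fin n) → T → Set (k ⊔ a)
  Avoids R t = ∀ {x} → FreeIn x t → x ∉ R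

  -- The fuel m bounds the number of pending variables R, hence the unfolding depth.
  avoiding-reduct : (m : ℕ) (R : List (Fin n)) → length R ≤ m →
                    (t : T) → Σ T (λ t' → Obtainable φ t t' × Avoids R t')
  avoiding-reduct m R R≤m (const c)  = const c , ε , λ ()
  avoiding-reduct m R R≤m (letter b) = letter b , ε , λ ()
  avoiding-reduct m R R≤m (var x) with Any.any? (x ≟_) R
  ... | no x∉R = var x , ε , λ { fr-var → x∉R }
  avoiding-reduct (suc m) R R≤m (var x) | yes x∈R
    with u , φx↝u , u-avoids ← avoiding-reduct m (delete x R) (length-delete≤ x∈R R≤m) (φ x)
    = μ x u , unfold-obtainable φx↝u ,
      λ { (fr-mu y≢x y-free) y∈R → u-avoids y-free (∈-delete⁺ y≢x y∈R) }
  avoiding-reduct zero (_ ∷ _) () (var x) | yes _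
  avoiding-reduct m R R≤m (s ⊕ t)
    with s' , s↝s' , s'-avoids ← avoiding-reduct m R R≤m s
       | t' , t↝t' , t'-avoids ← avoiding-reduct m R R≤m t
    = s' ⊕ t' , ⊕-obtainable s↝s' t↝t' ,
      λ { (fr-plusˡ free) → s'-avoids free ; (fr-plusʳ free) → t'-avoids free }
  avoiding-reduct m R R≤m (s ⊗ t)
    with s' , s↝s' , s'-avoids ← avoiding-reduct m R R≤m s
       | t' , t↝t' , t'-avoids ← avoiding-reduct m R R≤m t
    = s' ⊗ t' , ⊗-obtainable s↝s' t↝t' ,
      λ { (fr-timesˡ free) → s'-avoids free ; (fr-timesʳ free) → t'-avoids free }
  avoiding-reduct m R R≤m (μ y u)
    with u' , u↝u' , u'-avoids ← avoiding-reduct m R R≤m u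
    = μ y u' , μ-obtainable u↝u' , λ { (fr-mu _ free) → u'-avoids free }

  closure : (t : T) → Σ T (λ t' → Obtainable φ t t' × (∀ {x} → ¬ FreeIn x t'))
  closure t with t' , t↝t' , t'-avoids ← avoiding-reduct _ (allFin n) ≤-refl t
    = t' , t↝t' , λ free → t'-avoids free (∈-allFin _)

proposition6p7 : ∀ {c ℓ a : Level} (K : CommutativeSemiring c ℓ) (m : ℕ) (A : Set a) (enumA : Fin m → A)
    (surjA : ∀ (b : A) → Σ (Fin m) (λ i → enumA i ≡ b))
    (n : ℕ) (Z : Subset n) (φ : Fin n → Term (CommutativeSemiring.Carrier K) A n)
    → (∀ x → GuardedExpr (φ x))
    → (t : Term (CommutativeSemiring.Carrier K) A n) → MuFree t
    → Σ (Term (CommutativeSemiring.Carrier K) A n) (λ t' → IsPseudoclosure φ Z t t')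
proposition6p7 _ _ _ _ _ _ _ φ _ t _
  with t' , t↝t' , t'-closed ← closure φ t
  = t' , t↝t' , λ x free → ⊥-elim (t'-closed free)
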